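{- Let $\Gamma$ be an abelian group written additively, $\pi$ a $\Gamma$-quotient labeling of a finite graph $G$, and $T$ a maximal forest of $G$. Then for every oriented bond $\vec B$ of $G$, $\varphi_{\pi,T}(\vec B)=\pi(\vec B)$.
   Context: A bond is a minimal nonempty edge cut; $\delta(X)$ is the set of non-loop edges with exactly one endpoint in a vertex set $X$. An oriented bond $\vec B$ is a bond $\delta(X)$ with all edges oriented away from $X$ or all towards $X$. A $\Gamma$-gain function assigns to each oriented edge $e$ a value $\varphi(e)\in\Gamma$ with $\varphi(-e)=-\varphi(e)$ ($-e$ the reverse orientation), and $\varphi(\vec B)=\sum_{e\in\vec B}\varphi(e)$. A $\Gamma$-quotient labeling is a map $\pi:V(G)\to\Gamma$ with $\sum_{v\in V(H)}\pi(v)=0$ for each connected component $H$; write $\pi(X)=\sum_{v\in X}\pi(v)$, and for a bond $\delta(X)$ oriented towards $X$ set $\pi(\vec B)=\pi(X)$ (so the reverse orientation gets $-\pi(X)$). The gain function $\varphi_{\pi,T}$ is defined by: $\varphi_{\pi,T}(e)=0$ for edges $e\notin T$; for an edge $e\in T$, removing $e$ from $T$ splits one tree of $T$ into two trees; let $X$ be the vertex set of one of them, so that $B=\delta(X)$ is the bond of edges of $G$ joining the two trees; orient $e$ towards $X$ and set $\varphi_{\pi,T}(e)=\pi(X)$ (this is independent of the choice of side). -}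

module Defs where

open import Level using (Level; _⊔_)
open import Data.Nat.Base using (ℕ)
open import Data.Fin.Base using (Fin)
import Data.Fin
import Relation.Nullary
open import Data.Bool.Base using (Bool; true; false; if_then_else_; _xor_; _∨_)
open import Data.List.Base using (List; []; _∷_)
open import Data.List.Relation.Unary.Unique.Propositional using (Unique)
open import Data.Product using (Σ; ∃; _×_; _,_)
open import Data.Sum using (_⊎_)
open import Relation.Binary.PropositionalEquality using (_≡_; _≢_)
open import Relation.Nullary using (¬_)
open import Function.Bundles using (_⇔_)
open import Algebra.Bundles using (AbelianGroup)
import Algebra.Properties.Monoid.Sum as MonoidSum

-- Finite multigraphs (loops and parallel edges allowed).
-- Vertices are Fin n, edges are Fin m; every edge e carries a fixed
-- reference orientation  src e → tgt e  (a loop has src e ≡ tgt e).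

record Graph : Set where
  field
    n   : ℕ
    m   : ℕ
    src : Fin m → Fin n
    tgt : Fin m → Fin n

open Graph public

VSet : Graph → Set
VSet G = Fin (n G) → Bool

ESet : Graph → Set
ESet G = Fin (m G) → Bool

module _ (G : Graph) where

  allEdges : ESet G
  allEdges _ = true

  _without_ : ESet G → Fin (m G) → ESet G
  (S without e) f with e Data.Fin.≟ f
  ... | Relation.Nullary.yes _ = false
  ... | Relation.Nullary.no  _ = S f

  _with'_ : ESet G → Fin (m G) → ESet G
  (S with' e) f with e Data.Fin.≟ f
  ... | Relation.Nullary.yes _ = true
  ... | Relation.Nullary.no  _ = S f

  Joins : Fin (m G) → Fin (n G) → Fin (n G) → Set
  Joins e u w = (src G e ≡ u × tgt G e ≡ w) ⊎ (src G e ≡ w × tgt G e ≡ u)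

  data Walk (S : ESet G) : Fin (n G) → Fin (n G) → List (Fin (m G)) → Set where
    nil  : ∀ {v} → Walk S v v []
    cons : ∀ {e u w v es} → S e ≡ true → Joins e u w →
           Walk S w v es → Walk S u v (e ∷ es)

  Reach : ESet G → Fin (n G) → Fin (n G) → Set
  Reach S u v = ∃ λ es → Walk S u v es

  HasCycle : ESet G → Set
  HasCycle S = ∃ λ v → ∃ λ es → Walk S v v es × es ≢ [] × Unique es

  IsForest : ESet G → Set
  IsForest S = ¬ HasCycle S

  IsMaximalForest : ESet G → Set
  IsMaximalForest T =
    IsForest T × (∀ e → T e ≡ false → ¬ IsForest (T with' e))

  -- δ(X): non-loop edges with exactly one endpoint in X
  -- (for a loop src ≡ tgt, so the xor is false)
  δ : VSet G → ESet G
  δ X e = X (src G e) xor X (tgt G e)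

  IsCut : ESet G → Set
  IsCut F = ∃ λ (Y : VSet G) → ∀ e → F e ≡ δ Y e

  Nonempty : ESet G → Set
  Nonempty F = ∃ λ e → F e ≡ true

  _⊆_ : ESet G → ESet G → Set
  F ⊆ F' = ∀ e → F e ≡ true → F' e ≡ true

  IsBond : ESet G → Set
  IsBond F = IsCut F × Nonempty F ×
             (∀ F' → IsCut F' → Nonempty F' → F' ⊆ F → F ⊆ F')

module _ {c ℓ} (Γ : AbelianGroup c ℓ) (G : Graph) where
  open AbelianGroup Γ
  open MonoidSum monoid using (sum)

  labelSum : (Fin (n G) → Carrier) → VSet G → Carrier
  labelSum π X = sum (λ v → if X v then π v else ε)

  IsQuotientLabeling : (Fin (n G) → Carrier) → Set ℓ
  IsQuotientLabeling π =
    ∀ (v : Fin (n G)) (X : VSet G) →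
    (∀ u → (X u ≡ true) ⇔ Reach G (allEdges G) v u) →
    labelSum π X ≈ ε

  -- A gain function is given by its value φ e on each edge e in the
  -- reference orientation src e → tgt e; the reverse orientation gets  φ e ⁻¹.
  -- Value of φ on edge e oriented towards the vertex set X
  -- (used only for e ∈ δ(X), where exactly one endpoint lies in X):
  gainTowards : (Fin (m G) → Carrier) → VSet G → Fin (m G) → Carrier
  gainTowards φ X e = if X (tgt G e) then φ e else φ e ⁻¹

  bondGain : (Fin (m G) → Carrier) → VSet G → Carrier
  bondGain φ X = sum (λ e → if δ G X e then gainTowards φ X e else ε)

  IsPiTGain : (Fin (n G) → Carrier) → ESet G → (Fin (m G) → Carrier) → Set ℓ
  IsPiTGain π T φ =
    (∀ e → T e ≡ false → φ e ≈ ε) ×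
    (∀ e → T e ≡ true → ∀ (X : VSet G) →
       (∀ u → (X u ≡ true) ⇔ Reach G (_without_ G T e) (tgt G e) u) →
       φ e ≈ labelSum π X)

{-# OPTIONS --safe #-}
-- The gain of a cut is additive in the vertex set: an edge inside X occurs in the cuts of both
-- of its endpoints, once in each direction. So it suffices to treat X = {v}. Deleting v from its
-- component C leaves the branches of T at v, one for each T-edge at v; oriented towards v, such
-- an edge carries minus the label sum of its branch, because the two sides of a tree edge
-- partition C, on which π sums to zero. Hence φ(δ{v}) = -π(C ∖ {v}) = π(v).
module Submission where

open import Defs
open import Algebra.Bundles using (AbelianGroup)
import Algebra.Properties.AbelianGroup as AbelianGroupProperties
import Algebra.Properties.CommutativeMonoid.Sum as CommutativeMonoidSum
import Algebra.Properties.Group as GroupProperties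
import Algebra.Properties.Monoid.Sum as MonoidSum
open import Data.Bool.Base using (Bool; true; false; if_then_else_; _∧_; not)
open import Data.Empty using (⊥)
open import Data.Fin.Base using (Fin; zero; suc)
open import Data.Fin.Properties using (_≟_)
open import Data.List.Base using (List; []; _∷_; allFin)
open import Data.List.Membership.Propositional using (_∈_)
open import Data.List.Membership.Propositional.Properties using (∈-allFin)
import Data.List.Membership.DecPropositional as DecMembership
open import Data.List.Relation.Unary.All as All using (All; []; _∷_)
open import Data.List.Relation.Unary.All.Properties using (¬Any⇒All¬)
open import Data.List.Relation.Unary.Any using (here; there)
open import Data.List.Relation.Unary.AllPairs using ([]; _∷_)
open import Data.List.Relation.Unary.Unique.Propositional using (Unique)
open import Data.Nat.Base using (ℕ; zero; suc)
open import Data.Product using (∃; ∃₂; _×_; _,_; proj₁; proj₂; uncurry)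
open import Data.Sum as Sum using (_⊎_; inj₁; inj₂)
open import Data.Sum.Function.Propositional using (_⊎-⇔_)
open import Function.Base using (_∘_)
open import Function.Bundles using (_⇔_; mk⇔; Equivalence)
open import Function.Properties.Equivalence using () renaming (sym to ⇔-sym; trans to ⇔-trans)
open import Relation.Binary.Definitions using (Decidable)
import Relation.Binary.PropositionalEquality as ≡
open ≡ using (_≡_; _≢_)
import Relation.Binary.Reasoning.Setoid as SetoidReasoning
open import Relation.Nullary using (¬_; yes; no; does; contradiction)
open import Relation.Nullary.Decidable as Dec using (map′; _⊎-dec_; _×-dec_)

module Reachability (G : Graph) where

  open ≡ using (refl; sym; trans; ≢-sym)

  private
    V = Fin (n G)
    E = Fin (m G)
    variable
      S S′ : ESet G
      a b x y u w : V
      e f g : E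
      es : List E

  open DecMembership (_≟_ {m G}) using (_∈?_)

  ⁅_⁆ : V → VSet G
  ⁅ v ⁆ u = does (u ≟ v)

  _∖_ : ESet G → E → ESet G
  S ∖ e = _without_ G S e

  ∖⁺ : S g ≡ true → e ≢ g → (S ∖ e) g ≡ true
  ∖⁺ {g = g} {e = e} s e≢g with e ≟ g
  ... | yes e≡g = contradiction e≡g e≢g
  ... | no _    = s

  ∖⁻ : ∀ e → (S ∖ e) g ≡ true → S g ≡ true × e ≢ g
  ∖⁻ {g = g} e s with e ≟ g
  ... | no e≢g = s , e≢g

  ∖-⊆ : ∀ e → _⊆_ G (S ∖ e) S
  ∖-⊆ {S = S} e g = proj₁ ∘ ∖⁻ {S = S} e

  ∖∖-⊆ : ∀ e f → _⊆_ G ((S ∖ f) ∖ e) (S ∖ e)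
  ∖∖-⊆ {S = S} e f g s with ∖⁻ {S = S ∖ f} e s
  ... | s′ , e≢g = ∖⁺ (proj₁ (∖⁻ {S = S} f s′)) e≢g

  with'⁻ : _with'_ G S e g ≡ true → e ≡ g ⊎ S g ≡ true
  with'⁻ {e = e} {g = g} s with e ≟ g
  ... | yes e≡g = inj₁ e≡g
  ... | no _    = inj₂ s

  joins-sym : Joins G e x y → Joins G e y x
  joins-sym = Sum.swap

  joins-endpoint : Joins G e x y → Joins G e a b → a ≡ x ⊎ a ≡ y
  joins-endpoint (inj₁ (refl , refl)) (inj₁ (refl , _)) = inj₁ refl
  joins-endpoint (inj₁ (refl , refl)) (inj₂ (_ , refl)) = inj₂ refl
  joins-endpoint (inj₂ (refl , refl)) (inj₁ (refl , _)) = inj₂ refl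
  joins-endpoint (inj₂ (refl , refl)) (inj₂ (_ , refl)) = inj₁ refl

  walk-mono : _⊆_ G S S′ → Walk G S a b es → Walk G S′ a b es
  walk-mono S⊆S′ nil          = nil
  walk-mono S⊆S′ (cons s j w) = cons (S⊆S′ _ s) j (walk-mono S⊆S′ w)

  reach-mono : _⊆_ G S S′ → Reach G S a b → Reach G S′ a b
  reach-mono S⊆S′ (_ , w) = _ , walk-mono S⊆S′ w

  reach-refl : Reach G S a a
  reach-refl = [] , nil

  reach-≡ : a ≡ b → Reach G S a b
  reach-≡ refl = reach-refl

  reach-step : S e ≡ true → Joins G e a b → Reach G S a b
  reach-step s j = _ , cons s j nil

  reach-trans : Reach G S a b → Reach G S b w → Reach G S a w
  reach-trans (_ , nil)        r = r
  reach-trans (_ , cons s j w) r with reach-trans (_ , w) r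
  ... | _ , w′ = _ , cons s j w′

  reach-sym : Reach G S a b → Reach G S b a
  reach-sym (_ , nil)        = reach-refl
  reach-sym (_ , cons s j w) = reach-trans (reach-sym (_ , w)) (reach-step s (joins-sym j))

  reach-src-tgt : S e ≡ true → Reach G S (src G e) (tgt G e)
  reach-src-tgt s = reach-step s (inj₁ (refl , refl))

  reach-ends⁺ : Joins G e x y → Reach G S (src G e) (tgt G e) → Reach G S x y
  reach-ends⁺ (inj₁ (refl , refl)) r = r
  reach-ends⁺ (inj₂ (refl , refl)) r = reach-sym r

  reach-ends⁻ : Joins G e x y → Reach G S x y → Reach G S (src G e) (tgt G e)
  reach-ends⁻ (inj₁ (refl , refl)) r = r
  reach-ends⁻ (inj₂ (refl , refl)) r = reach-sym r

  with'-∖-⊆ : ∀ e → _⊆_ G ((_with'_ G S e) ∖ e) S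
  with'-∖-⊆ {S = S} e g s with ∖⁻ {S = _with'_ G S e} e s
  ... | s′ , e≢g with with'⁻ {S = S} s′
  ...   | inj₁ e≡g = contradiction e≡g e≢g
  ...   | inj₂ s″  = s″

  reach-avoiding : Joins G e x y → Reach G S a b →
                   Reach G (S ∖ e) a b ⊎ Reach G (S ∖ e) a x ⊎ Reach G (S ∖ e) a y
  reach-avoiding j (_ , nil) = inj₁ reach-refl
  reach-avoiding {e = e} j (_ , cons {e = g} s k w) with e ≟ g | reach-avoiding j (_ , w)
  ... | yes refl | _    = inj₂ (Sum.map reach-≡ reach-≡ (joins-endpoint j k))
  ... | no e≢g   | rest = Sum.map (reach-trans first) (Sum.map (reach-trans first) (reach-trans first)) rest
    where first = reach-step (∖⁺ s e≢g) k

  reach-src-via : S e ≡ true → Reach G (S ∖ e) a (src G e) ⊎ Reach G (S ∖ e) a (tgt G e) →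
                  Reach G S a (src G e)
  reach-src-via {e = e} s (inj₁ r) = reach-mono (∖-⊆ e) r
  reach-src-via {e = e} s (inj₂ r) = reach-trans (reach-mono (∖-⊆ e) r) (reach-sym (reach-src-tgt s))

  reach-∖⇔ : S e ≡ true →
             Reach G S a b ⇔
             (Reach G (S ∖ e) a b ⊎
              ((Reach G (S ∖ e) a (src G e) ⊎ Reach G (S ∖ e) a (tgt G e)) ×
               (Reach G (S ∖ e) b (src G e) ⊎ Reach G (S ∖ e) b (tgt G e))))
  reach-∖⇔ {e = e} s = mk⇔ to from
    where
    to : Reach G _ _ _ → _
    to r with reach-avoiding (inj₁ (refl , refl)) r
    ... | inj₁ r′ = inj₁ r′
    ... | inj₂ near-a with reach-avoiding (inj₁ (refl , refl)) (reach-sym r)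
    ...   | inj₁ r′     = inj₁ (reach-sym r′)
    ...   | inj₂ near-b = inj₂ (near-a , near-b)
    from : _ → Reach G _ _ _
    from (inj₁ r)                 = reach-mono (∖-⊆ e) r
    from (inj₂ (near-a , near-b)) = reach-trans (reach-src-via s near-a) (reach-sym (reach-src-via s near-b))

  reach?-∖ : S e ≡ true → Decidable (Reach G (S ∖ e)) → Decidable (Reach G S)
  reach?-∖ {e = e} s d a b =
    Dec.map (⇔-sym (reach-∖⇔ s))
      (d a b ⊎-dec ((d a (src G e) ⊎-dec d a (tgt G e)) ×-dec (d b (src G e) ⊎-dec d b (tgt G e))))

  reach?-within : ∀ (L : List E) S → (∀ g → S g ≡ true → g ∈ L) → Decidable (Reach G S)
  reach?-within [] S S⊆[] a b = map′ (λ { refl → reach-refl }) no-edge (a ≟ b)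
    where
    no-edge : Reach G S a b → a ≡ b
    no-edge (_ , nil)             = refl
    no-edge (_ , cons {e = g} s _ _) with () ← S⊆[] g s
  reach?-within (f ∷ L) S S⊆f∷L with S f in sf | reach?-within L (S ∖ f) S∖f⊆L
    where
    S∖f⊆L : ∀ g → (S ∖ f) g ≡ true → g ∈ L
    S∖f⊆L g s with ∖⁻ {S = S} f s
    ... | s′ , f≢g with S⊆f∷L g s′
    ...   | here g≡f = contradiction (sym g≡f) f≢g
    ...   | there g∈L = g∈L
  ... | true  | d = reach?-∖ sf d
  ... | false | d = λ a b → map′ (reach-mono (∖-⊆ f)) (reach-mono S⊆S∖f) (d a b)
    where
    S⊆S∖f : _⊆_ G S (S ∖ f)
    S⊆S∖f g s = ∖⁺ {e = f} s λ { refl → contradiction (trans (sym s) sf) λ () }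

  reach? : ∀ S → Decidable (Reach G S)
  reach? S = reach?-within (allFin (m G)) S (λ g _ → ∈-allFin g)

  reachable : ESet G → V → VSet G
  reachable S a u = does (reach? S a u)

  reachable-spec : (reachable S a u ≡ true) ⇔ Reach G S a u
  reachable-spec {S = S} {a = a} {u = u} with reach? S a u
  ... | yes r = mk⇔ (λ _ → r) (λ _ → refl)
  ... | no ¬r = mk⇔ (λ ()) (λ r → contradiction r ¬r)

  Trail : ESet G → V → V → Set
  Trail S a b = ∃ λ es → Walk G S a b es × Unique es

  walk-∖⁺ : Walk G S a b es → All (e ≢_) es → Walk G (S ∖ e) a b es
  walk-∖⁺ nil          []           = nil
  walk-∖⁺ (cons s j w) (e≢g ∷ e≢es) = cons (∖⁺ s e≢g) j (walk-∖⁺ w e≢es)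

  walk-∖⁻ : Walk G (S ∖ e) a b es → All (e ≢_) es
  walk-∖⁻                 nil          = []
  walk-∖⁻ {S = S} {e = e} (cons s _ w) = proj₂ (∖⁻ {S = S} e s) ∷ walk-∖⁻ w

  trail-split : Walk G S a b es → Unique es → f ∈ es →
                ∃₂ λ y₁ y₂ → Joins G f y₁ y₂ × Reach G (S ∖ f) a y₁ × Trail (S ∖ f) y₂ b
  trail-split (cons s j w) (g∉es ∷ u) (here refl) = _ , _ , j , reach-refl , (_ , walk-∖⁺ w g∉es , u)
  trail-split (cons s j w) (g∉es ∷ u) (there f∈es) with trail-split w u f∈es
  ... | y₁ , y₂ , jf , r , t =
    y₁ , y₂ , jf , reach-trans (reach-step (∖⁺ s (≢-sym (All.lookup g∉es f∈es))) j) r , t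

  trailify : Walk G S a b es → Trail S a b
  trailify nil = [] , nil , []
  trailify (cons {e = f} s j w) with trailify w
  ... | es′ , w′ , u′ with f ∈? es′
  ...   | no f∉es′ = f ∷ es′ , cons s j w′ , ¬Any⇒All¬ es′ f∉es′ ∷ u′
  ...   | yes f∈es′ with trail-split w′ u′ f∈es′
  ...     | _ , _ , jf , _ , (es″ , w″ , u″) with joins-endpoint j (joins-sym jf)
  -- the suffix after f starts at an endpoint of f: at a, or at the vertex after a
  ...       | inj₁ refl = es″ , walk-mono (∖-⊆ f) w″ , u″
  ...       | inj₂ refl = f ∷ es″ , cons s j (walk-mono (∖-⊆ f) w″) , walk-∖⁻ w″ ∷ u″

module Forests (G : Graph) where

  open ≡ using (refl)
  open Reachability G
  open DecMembership (_≟_ {m G}) using (_∈?_)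

  private
    variable
      T S : ESet G
      a b x y u : Fin (n G)
      e : Fin (m G)

  bridge : IsForest G T → T e ≡ true → Joins G e x y → ¬ Reach G (T ∖ e) x y
  bridge {e = e} forest te j r with trailify (proj₂ (reach-sym (reach-ends⁻ j r)))
  ... | es , w , u =
    forest (src G e , e ∷ es , cons te (inj₁ (refl , refl)) (walk-mono (∖-⊆ e) w) , (λ ()) ,
            walk-∖⁻ w ∷ u)

  cycle-closed-by : IsForest G T → HasCycle G (_with'_ G T e) → Reach G T (src G e) (tgt G e)
  cycle-closed-by {e = e} forest (v , es , w , nonempty , u) with e ∈? es
  ... | no e∉es =
    contradiction (v , es , walk-mono (with'-∖-⊆ e) (walk-∖⁺ w (¬Any⇒All¬ es e∉es)) , nonempty , u)
                  forest
  ... | yes e∈es with trail-split w u e∈es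
  ...   | _ , _ , j , r , (_ , w′ , _) =
    reach-ends⁻ (joins-sym j) (reach-mono (with'-∖-⊆ e) (reach-trans (_ , w′) r))

  maximal-forest-connects-ends : IsMaximalForest G T → ∀ e → Reach G T (src G e) (tgt G e)
  maximal-forest-connects-ends {T = T} (forest , maximal) e with T e in te | reach? T (src G e) (tgt G e)
  ... | true  | _     = reach-src-tgt te
  ... | false | yes r = r
  ... | false | no ¬r = contradiction (¬r ∘ cycle-closed-by forest) (maximal e te)

  maximal-forest-spans : IsMaximalForest G T → Reach G S a b → Reach G T a b
  maximal-forest-spans mf (_ , nil)              = reach-refl
  maximal-forest-spans mf (_ , cons {e = g} _ j w) =
    reach-trans (reach-ends⁺ j (maximal-forest-connects-ends mf g)) (maximal-forest-spans mf (_ , w))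

  tree-edge-sides : IsMaximalForest G T → T e ≡ true → Joins G e x y →
                    Reach G (allEdges G) x u ⇔ (Reach G (T ∖ e) x u ⊎ Reach G (T ∖ e) y u)
  tree-edge-sides mf te j = mk⇔ to from
    where
    to : Reach G (allEdges G) _ _ → _
    to r with reach-avoiding j (reach-sym (maximal-forest-spans mf r))
    ... | inj₁ r′        = inj₁ (reach-sym r′)
    ... | inj₂ (inj₁ r′) = inj₁ (reach-sym r′)
    ... | inj₂ (inj₂ r′) = inj₂ (reach-sym r′)
    from : _ → Reach G (allEdges G) _ _
    from (inj₁ r) = reach-mono (λ _ _ → refl) r
    from (inj₂ r) = reach-trans (reach-step refl j) (reach-mono (λ _ _ → refl) r)

module Branches (G : Graph) (T : ESet G) (mf : IsMaximalForest G T) (v : Fin (n G)) where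

  open ≡ using (refl; sym; trans; cong; ≢-sym)

  open Reachability G
  open Forests G

  private
    variable
      a u w : Fin (n G)
      e e′ g : Fin (m G)
      es : List (Fin (m G))

  incident : Fin (m G) → Bool
  incident e = T e ∧ δ G ⁅ v ⁆ e

  far : Fin (m G) → Fin (n G)
  far e = if ⁅ v ⁆ (tgt G e) then src G e else tgt G e

  incident⁻ : incident e ≡ true → T e ≡ true × Joins G e v (far e)
  incident⁻ {e = e} h with T e | src G e ≟ v | tgt G e ≟ v
  incident⁻ h  | true | yes sv | no _   = refl , inj₁ (sv , refl)
  incident⁻ h  | true | no _   | yes tv = refl , inj₂ (refl , tv)
  incident⁻ () | true | yes _  | yes _
  incident⁻ () | true | no _   | no _
  incident⁻ () | false | _     | _

  incident⁺ : T g ≡ true → Joins G g v w → w ≢ v → incident g ≡ true × far g ≡ w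
  incident⁺ {g = g} tg j w≢v with src G g ≟ v | tgt G g ≟ v | j
  ... | yes _  | no _   | inj₁ (_ , tw) = cong (_∧ true) tg , tw
  ... | no _   | yes _  | inj₂ (sw , _) = cong (_∧ true) tg , sw
  ... | _      | yes tv | inj₁ (_ , tw) = contradiction (trans (sym tw) tv) w≢v
  ... | yes sv | _      | inj₂ (sw , _) = contradiction (trans (sym sw) sv) w≢v
  ... | no s≢v | _      | inj₁ (sv , _) = contradiction sv s≢v
  ... | _      | no t≢v | inj₂ (_ , tv) = contradiction tv t≢v

  InBranch : Fin (n G) → Set
  InBranch u = ∃ λ e → incident e ≡ true × Reach G (T ∖ e) (far e) u

  branch-⊆-component∖v : incident e ≡ true → Reach G (T ∖ e) (far e) u →
                         Reach G (allEdges G) v u × u ≢ v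
  branch-⊆-component∖v h r with incident⁻ h
  ... | te , j = reach-trans (reach-step refl j) (reach-mono (λ _ _ → refl) r) ,
                 λ { refl → bridge (proj₁ mf) te (joins-sym j) r }

  branch-step : T g ≡ true → Joins G g a w → a ≡ v ⊎ InBranch a → w ≡ v ⊎ InBranch w
  branch-step {g = g} {w = w} tg j (inj₁ refl) with w ≟ v
  ... | yes w≡v = inj₁ w≡v
  ... | no w≢v with incident⁺ tg j w≢v
  ...   | h , far≡w = inj₂ (g , h , reach-≡ far≡w)
  branch-step {g = g} tg j (inj₂ (e , h , r)) with e ≟ g
  ... | no e≢g = inj₂ (e , h , reach-trans r (reach-step (∖⁺ tg e≢g) j))
  ... | yes refl with joins-endpoint (proj₂ (incident⁻ h)) (joins-sym j)
  ...   | inj₁ w≡v   = inj₁ w≡v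
  ...   | inj₂ w≡far = inj₂ (e , h , reach-≡ (sym w≡far))

  branch-walk : Walk G T a u es → a ≡ v ⊎ InBranch a → u ≡ v ⊎ InBranch u
  branch-walk nil          q = q
  branch-walk (cons tg j w) q = branch-walk w (branch-step tg j q)

  branches-cover : Reach G (allEdges G) v u → u ≢ v → InBranch u
  branches-cover r u≢v with branch-walk (proj₂ (maximal-forest-spans mf r)) (inj₁ refl)
  ... | inj₁ u≡v = contradiction u≡v u≢v
  ... | inj₂ b   = b

  branches-disjoint : incident e ≡ true → incident e′ ≡ true →
                      Reach G (T ∖ e) (far e) u → Reach G (T ∖ e′) (far e′) u → e ≡ e′
  branches-disjoint {e = e} {e′ = e′} h h′ r r′ with e ≟ e′
  ... | yes e≡e′ = e≡e′
  ... | no e≢e′ with incident⁻ h | incident⁻ h′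
  ...   | te , j | te′ , j′ with reach-avoiding j r′
  ...     | inj₁ r″ =
    contradiction (reach-trans r (reach-trans (reach-sym (reach-mono (∖∖-⊆ e e′) r″))
                                              (reach-step (∖⁺ te′ e≢e′) (joins-sym j′))))
                  (bridge (proj₁ mf) te (joins-sym j))
  ...     | inj₂ (inj₁ r″) =
    contradiction (reach-mono (∖-⊆ e) r″) (bridge (proj₁ mf) te′ (joins-sym j′))
  ...     | inj₂ (inj₂ r″) =
    contradiction (reach-trans (reach-mono (∖-⊆ e) r″)
                               (reach-step (∖⁺ te (≢-sym e≢e′)) (joins-sym j)))
                  (bridge (proj₁ mf) te′ (joins-sym j′))

  branch : Fin (m G) → VSet G
  branch e = reachable (T ∖ e) (far e)

  component∖v : VSet G
  component∖v u = reachable (allEdges G) v u ∧ not (does (v ≟ u))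

  in-branch-spec : (incident e ∧ branch e u ≡ true) ⇔ (incident e ≡ true × Reach G (T ∖ e) (far e) u)
  in-branch-spec {e = e} {u = u} with incident e | reach? (T ∖ e) (far e) u
  ... | true  | yes r = mk⇔ (λ _ → refl , r) (λ _ → refl)
  ... | true  | no ¬r = mk⇔ (λ ()) (λ (_ , r) → contradiction r ¬r)
  ... | false | _     = mk⇔ (λ ()) (λ { (() , _) })

  component∖v-spec : (component∖v u ≡ true) ⇔ (Reach G (allEdges G) v u × u ≢ v)
  component∖v-spec {u = u} with reach? (allEdges G) v u | v ≟ u
  ... | yes r | no v≢u  = mk⇔ (λ _ → r , ≢-sym v≢u) (λ _ → refl)
  ... | yes _ | yes v≡u = mk⇔ (λ ()) (λ (_ , u≢v) → contradiction (sym v≡u) u≢v)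
  ... | no ¬r | _       = mk⇔ (λ ()) (λ (r , _) → contradiction r ¬r)

  in-branch⇒component∖v : incident e ∧ branch e u ≡ true → component∖v u ≡ true
  in-branch⇒component∖v =
    Equivalence.from component∖v-spec ∘ uncurry branch-⊆-component∖v ∘ Equivalence.to in-branch-spec

  component∖v⇒unique-branch :
    component∖v u ≡ true →
    ∃ λ e₀ → incident e₀ ∧ branch e₀ u ≡ true × ∀ e → incident e ∧ branch e u ≡ true → e₀ ≡ e
  component∖v⇒unique-branch c with Equivalence.to component∖v-spec c
  ... | r , u≢v with branches-cover r u≢v
  ...   | e₀ , h₀ , r₀ = e₀ , Equivalence.from in-branch-spec (h₀ , r₀) ,
                         λ e b → let h , r = Equivalence.to in-branch-spec b in branches-disjoint h₀ h r₀ r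

module FinSums {c ℓ} (Γ : AbelianGroup c ℓ) where

  open AbelianGroup Γ
  open MonoidSum monoid using (sum; sum-cong-≋; sum-replicate-zero)
  open CommutativeMonoidSum commutativeMonoid using (∑-distrib-+)
  open AbelianGroupProperties Γ using (⁻¹-∙-comm)
  open GroupProperties group using (ε⁻¹≈ε)

  private
    variable
      k : ℕ
      x y : Carrier

  if-cong : ∀ b → x ≈ y → (if b then x else ε) ≈ (if b then y else ε)
  if-cong true  x≈y = x≈y
  if-cong false _   = refl

  if-∙ : ∀ b x y → (if b then x ∙ y else ε) ≈ (if b then x else ε) ∙ (if b then y else ε)
  if-∙ true  x y = refl
  if-∙ false x y = sym (identityˡ ε)

  if-⁻¹ : ∀ b x → (if b then x ⁻¹ else ε) ≈ (if b then x else ε) ⁻¹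
  if-⁻¹ true  x = refl
  if-⁻¹ false x = sym ε⁻¹≈ε

  if-if : ∀ b c x → (if b then (if c then x else ε) else ε) ≡ (if b ∧ c then x else ε)
  if-if true  c x = ≡.refl
  if-if false c x = ≡.refl

  if-comm : ∀ b c x → (if b then (if c then x else ε) else ε) ≡ (if c then (if b then x else ε) else ε)
  if-comm true  true  x = ≡.refl
  if-comm true  false x = ≡.refl
  if-comm false true  x = ≡.refl
  if-comm false false x = ≡.refl

  ∑-zero : {f : Fin k → Carrier} → (∀ i → f i ≈ ε) → sum f ≈ ε
  ∑-zero {k} f≈ε = trans (sum-cong-≋ f≈ε) (sum-replicate-zero k)

  if-∑ : ∀ b (f : Fin k → Carrier) → (if b then sum f else ε) ≈ sum (λ i → if b then f i else ε)
  if-∑ true  f = refl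
  if-∑ {k} false f = sym (∑-zero {k} λ _ → refl)

  ∑-⁻¹ : (f : Fin k → Carrier) → sum (λ i → f i ⁻¹) ≈ sum f ⁻¹
  ∑-⁻¹ {zero}  f = sym ε⁻¹≈ε
  ∑-⁻¹ {suc k} f = trans (∙-congˡ (∑-⁻¹ (f ∘ suc))) (⁻¹-∙-comm (f zero) (sum (f ∘ suc)))

  ∑-δ : (j : Fin k) (f : Fin k → Carrier) → sum (λ i → if does (j ≟ i) then f i else ε) ≈ f j
  ∑-δ {suc k} zero f = trans (∙-congˡ (∑-zero {k} λ _ → refl)) (identityʳ (f zero))
  ∑-δ {suc k} (suc j) f = trans (identityˡ _) (∑-δ j (f ∘ suc))

  ∑-select : (X : Fin k → Bool) (j : Fin k) (x : Carrier) →
             sum (λ i → if X i then (if does (j ≟ i) then x else ε) else ε) ≈ (if X j then x else ε)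
  ∑-select X j x = trans (sum-cong-≋ λ i → reflexive (if-comm (X i) (does (j ≟ i)) x))
                         (∑-δ j λ i → if X i then x else ε)

  ∑-if-unique : (P : Fin k → Bool) (b : Bool) (x : Carrier) →
                (∀ i → P i ≡ true → b ≡ true) →
                (b ≡ true → ∃ λ i₀ → P i₀ ≡ true × ∀ i → P i ≡ true → i₀ ≡ i) →
                sum (λ i → if P i then x else ε) ≈ (if b then x else ε)
  ∑-if-unique P false x P⊆b _ = ∑-zero pointwise
    where
    pointwise : ∀ i → (if P i then x else ε) ≈ ε
    pointwise i with P i in Pi
    ... | true  = contradiction (P⊆b i Pi) λ ()
    ... | false = refl
  ∑-if-unique P true x _ unique with unique ≡.refl
  ... | i₀ , Pi₀ , i₀-unique = trans (sum-cong-≋ pointwise) (∑-δ i₀ λ _ → x)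
    where
    pointwise : ∀ i → (if P i then x else ε) ≈ (if does (i₀ ≟ i) then x else ε)
    pointwise i with P i in Pi | i₀ ≟ i
    ... | true  | yes _      = refl
    ... | true  | no i₀≢i    = contradiction (i₀-unique i Pi) i₀≢i
    ... | false | yes ≡.refl = contradiction (≡.trans (≡.sym Pi₀) Pi) λ ()
    ... | false | no _       = refl

  ∑-if-∪ : (X Y Z : Fin k → Bool) (f : Fin k → Carrier) →
           (∀ i → (Z i ≡ true) ⇔ (X i ≡ true ⊎ Y i ≡ true)) →
           (∀ i → X i ≡ true → Y i ≡ true → ⊥) →
           sum (λ i → if X i then f i else ε) ∙ sum (λ i → if Y i then f i else ε) ≈
           sum (λ i → if Z i then f i else ε)
  ∑-if-∪ {k} X Y Z f Z⇔X∪Y disjoint = trans (sym (∑-distrib-+ {k} _ _)) (sum-cong-≋ pointwise)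
    where
    pointwise : ∀ i → (if X i then f i else ε) ∙ (if Y i then f i else ε) ≈ (if Z i then f i else ε)
    pointwise i with X i in Xi | Y i in Yi | Z i in Zi | Z⇔X∪Y i
    ... | true  | true  | _     | _     = contradiction Yi (disjoint i Xi)
    ... | true  | false | true  | _     = identityʳ (f i)
    ... | false | true  | true  | _     = identityˡ (f i)
    ... | false | false | false | _     = identityˡ ε
    ... | true  | false | false | Z⇔   with () ← Equivalence.from Z⇔ (inj₁ ≡.refl)
    ... | false | true  | false | Z⇔   with () ← Equivalence.from Z⇔ (inj₂ ≡.refl)
    ... | false | false | true  | Z⇔   with Equivalence.to Z⇔ ≡.refl
    ...   | inj₁ ()
    ...   | inj₂ ()

  ∑-if-∖ : (X : Fin k → Bool) (j : Fin k) (f : Fin k → Carrier) → X j ≡ true →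
           sum (λ i → if X i ∧ not (does (j ≟ i)) then f i else ε) ∙ f j ≈
           sum (λ i → if X i then f i else ε)
  ∑-if-∖ {k} X j f Xj =
    trans (∙-congˡ (sym (∑-δ j f))) (trans (sym (∑-distrib-+ {k} _ _)) (sum-cong-≋ pointwise))
    where
    pointwise : ∀ i → (if X i ∧ not (does (j ≟ i)) then f i else ε) ∙
                      (if does (j ≟ i) then f i else ε) ≈ (if X i then f i else ε)
    pointwise i with X i in Xi | j ≟ i
    ... | true  | yes _      = identityˡ (f i)
    ... | true  | no _       = identityʳ (f i)
    ... | false | yes ≡.refl = contradiction (≡.trans (≡.sym Xj) Xi) λ ()
    ... | false | no _       = identityˡ ε

module GainSums {c ℓ} (Γ : AbelianGroup c ℓ) (G : Graph) where

  open AbelianGroup Γ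
  open MonoidSum monoid using (sum; sum-cong-≋)
  open CommutativeMonoidSum commutativeMonoid using (∑-distrib-+; ∑-comm)
  open GroupProperties group using (ε⁻¹≈ε)
  open FinSums Γ
  open Reachability G using (⁅_⁆)
  open SetoidReasoning setoid

  crossingGain : (Fin (m G) → Carrier) → VSet G → Fin (m G) → Carrier
  crossingGain φ X e = if δ G X e then gainTowards Γ G φ X e else ε

  crossingGain-split : ∀ φ X e →
    crossingGain φ X e ≈ (if X (tgt G e) then φ e else ε) ∙ (if X (src G e) then φ e ⁻¹ else ε)
  crossingGain-split φ X e with X (src G e) | X (tgt G e)
  ... | true  | true  = sym (inverseʳ (φ e))
  ... | true  | false = sym (identityˡ (φ e ⁻¹))
  ... | false | true  = sym (identityʳ (φ e))
  ... | false | false = sym (identityˡ ε)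

  crossingGain-ε : ∀ φ X e → φ e ≈ ε → crossingGain φ X e ≈ ε
  crossingGain-ε φ X e φe≈ε with X (src G e) | X (tgt G e)
  ... | true  | true  = refl
  ... | true  | false = trans (⁻¹-cong φe≈ε) ε⁻¹≈ε
  ... | false | true  = φe≈ε
  ... | false | false = refl

  crossingGain-additive : ∀ φ X e →
    sum (λ v → if X v then crossingGain φ ⁅ v ⁆ e else ε) ≈ crossingGain φ X e
  crossingGain-additive φ X e = begin
    sum (λ v → if X v then crossingGain φ ⁅ v ⁆ e else ε)
      ≈⟨ sum-cong-≋ (λ v → if-cong (X v) (crossingGain-split φ ⁅ v ⁆ e)) ⟩
    sum (λ v → if X v then into v ∙ out v else ε)
      ≈⟨ sum-cong-≋ (λ v → if-∙ (X v) (into v) (out v)) ⟩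
    sum (λ v → (if X v then into v else ε) ∙ (if X v then out v else ε))
      ≈⟨ ∑-distrib-+ {n G} _ _ ⟩
    sum (λ v → if X v then into v else ε) ∙ sum (λ v → if X v then out v else ε)
      ≈⟨ ∙-cong (∑-select X (tgt G e) (φ e)) (∑-select X (src G e) (φ e ⁻¹)) ⟩
    (if X (tgt G e) then φ e else ε) ∙ (if X (src G e) then φ e ⁻¹ else ε)
      ≈⟨ crossingGain-split φ X e ⟨
    crossingGain φ X e ∎
    where
    into out : Fin (n G) → Carrier
    into v = if does (tgt G e ≟ v) then φ e else ε
    out  v = if does (src G e ≟ v) then φ e ⁻¹ else ε

  bondGain-additive : ∀ φ X →
    bondGain Γ G φ X ≈ sum (λ v → if X v then bondGain Γ G φ ⁅ v ⁆ else ε)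
  bondGain-additive φ X = begin
    sum (crossingGain φ X)
      ≈⟨ sum-cong-≋ (crossingGain-additive φ X) ⟨
    sum (λ e → sum (λ v → if X v then crossingGain φ ⁅ v ⁆ e else ε))
      ≈⟨ ∑-comm (λ e v → if X v then crossingGain φ ⁅ v ⁆ e else ε) ⟩
    sum (λ v → sum (λ e → if X v then crossingGain φ ⁅ v ⁆ e else ε))
      ≈⟨ sum-cong-≋ (λ v → if-∑ (X v) (crossingGain φ ⁅ v ⁆)) ⟨
    sum (λ v → if X v then bondGain Γ G φ ⁅ v ⁆ else ε) ∎

module QuotientGains {c ℓ} (Γ : AbelianGroup c ℓ) (G : Graph) (π : Fin (n G) → AbelianGroup.Carrier Γ)
  (quotient : IsQuotientLabeling Γ G π) (T : ESet G) (mf : IsMaximalForest G T)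
  (φ : Fin (m G) → AbelianGroup.Carrier Γ) (gain : IsPiTGain Γ G π T φ) where

  open AbelianGroup Γ
  open MonoidSum monoid using (sum; sum-cong-≋)
  open CommutativeMonoidSum commutativeMonoid using (∑-comm)
  open GroupProperties group using (inverseˡ-unique; ⁻¹-involutive)
  open FinSums Γ
  open GainSums Γ G
  open Reachability G
  open Forests G
  open SetoidReasoning setoid

  private
    variable
      e : Fin (m G)

  component-sum : ∀ a → labelSum Γ G π (reachable (allEdges G) a) ≈ ε
  component-sum a = quotient a _ λ _ → reachable-spec

  tree-edge-gain : T e ≡ true → φ e ≈ labelSum Γ G π (reachable (T ∖ e) (tgt G e))
  tree-edge-gain te = proj₂ gain _ te _ λ _ → reachable-spec

  tree-edge-gain-src : T e ≡ true → φ e ≈ labelSum Γ G π (reachable (T ∖ e) (src G e)) ⁻¹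
  tree-edge-gain-src {e} te = trans (tree-edge-gain te) (inverseˡ-unique _ _ sides-sum)
    where
    tgt-src : Joins G e (tgt G e) (src G e)
    tgt-src = inj₂ (≡.refl , ≡.refl)
    side : Fin (n G) → VSet G
    side a = reachable (T ∖ e) a
    sides-cover : ∀ u → (reachable (allEdges G) (tgt G e) u ≡ true) ⇔
                        (side (tgt G e) u ≡ true ⊎ side (src G e) u ≡ true)
    sides-cover _ =
      ⇔-trans reachable-spec
        (⇔-trans (tree-edge-sides mf te tgt-src) (⇔-sym reachable-spec ⊎-⇔ ⇔-sym reachable-spec))
    sides-disjoint : ∀ u → side (tgt G e) u ≡ true → side (src G e) u ≡ true → ⊥
    sides-disjoint _ r r′ = bridge (proj₁ mf) te tgt-src
      (reach-trans (Equivalence.to reachable-spec r) (reach-sym (Equivalence.to reachable-spec r′)))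
    sides-sum : labelSum Γ G π (side (tgt G e)) ∙ labelSum Γ G π (side (src G e)) ≈ ε
    sides-sum = trans (∑-if-∪ _ _ _ π sides-cover sides-disjoint) (component-sum (tgt G e))

  module AtVertex (v : Fin (n G)) where

    open Branches G T mf v

    crossingGain-⁅⁆ : ∀ e →
      crossingGain φ ⁅ v ⁆ e ≈ (if incident e then labelSum Γ G π (branch e) ⁻¹ else ε)
    crossingGain-⁅⁆ e with T e in te
    ... | false = crossingGain-ε φ ⁅ v ⁆ e (proj₁ gain e te)
    ... | true with src G e ≟ v | tgt G e ≟ v
    ...   | yes _ | yes _ = refl
    ...   | no _  | no _  = refl
    ...   | yes _ | no _  = ⁻¹-cong (tree-edge-gain te)
    ...   | no _  | yes _ = tree-edge-gain-src te

    branches-sum :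
      sum (λ e → if incident e then labelSum Γ G π (branch e) else ε) ≈ labelSum Γ G π component∖v
    branches-sum = begin
      sum (λ e → if incident e then sum (λ u → if branch e u then π u else ε) else ε)
        ≈⟨ sum-cong-≋ (λ e → trans (if-∑ (incident e) (λ u → if branch e u then π u else ε))
                                   (sum-cong-≋ λ u → reflexive (if-if (incident e) (branch e u) (π u)))) ⟩
      sum (λ e → sum (λ u → if incident e ∧ branch e u then π u else ε))
        ≈⟨ ∑-comm (λ e u → if incident e ∧ branch e u then π u else ε) ⟩
      sum (λ u → sum (λ e → if incident e ∧ branch e u then π u else ε))
        ≈⟨ sum-cong-≋ (λ u → ∑-if-unique _ (component∖v u) (π u)
                               (λ _ → in-branch⇒component∖v) component∖v⇒unique-branch) ⟩
      labelSum Γ G π component∖v ∎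

    component∖v-sum : labelSum Γ G π component∖v ∙ π v ≈ ε
    component∖v-sum =
      trans (∑-if-∖ (reachable (allEdges G) v) v π (Equivalence.from reachable-spec reach-refl))
            (component-sum v)

    bondGain-⁅⁆ : bondGain Γ G φ ⁅ v ⁆ ≈ π v
    bondGain-⁅⁆ = begin
      sum (crossingGain φ ⁅ v ⁆)
        ≈⟨ sum-cong-≋ crossingGain-⁅⁆ ⟩
      sum (λ e → if incident e then labelSum Γ G π (branch e) ⁻¹ else ε)
        ≈⟨ sum-cong-≋ (λ e → if-⁻¹ (incident e) _) ⟩
      sum (λ e → (if incident e then labelSum Γ G π (branch e) else ε) ⁻¹)
        ≈⟨ ∑-⁻¹ (λ e → if incident e then labelSum Γ G π (branch e) else ε) ⟩
      sum (λ e → if incident e then labelSum Γ G π (branch e) else ε) ⁻¹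
        ≈⟨ ⁻¹-cong (trans branches-sum (inverseˡ-unique _ _ component∖v-sum)) ⟩
      π v ⁻¹ ⁻¹
        ≈⟨ ⁻¹-involutive (π v) ⟩
      π v ∎

theorem4p6 : ∀ {c ℓ} (Γ : AbelianGroup c ℓ) (G : Graph)
    (π : Fin (n G) → AbelianGroup.Carrier Γ) →
    IsQuotientLabeling Γ G π →
    (T : ESet G) → IsMaximalForest G T →
    (φ : Fin (m G) → AbelianGroup.Carrier Γ) → IsPiTGain Γ G π T φ →
    (X : VSet G) → IsBond G (δ G X) →
    AbelianGroup._≈_ Γ (bondGain Γ G φ X) (labelSum Γ G π X)
theorem4p6 Γ G π quotient T mf φ gain X _ = begin
  bondGain Γ G φ X
    ≈⟨ bondGain-additive φ X ⟩
  sum (λ v → if X v then bondGain Γ G φ ⁅ v ⁆ else ε)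
    ≈⟨ sum-cong-≋ (λ v → if-cong (X v) (AtVertex.bondGain-⁅⁆ v)) ⟩
  labelSum Γ G π X ∎
  where
  open AbelianGroup Γ
  open MonoidSum monoid using (sum; sum-cong-≋)
  open SetoidReasoning setoid
  open FinSums Γ
  open GainSums Γ G
  open Reachability G using (⁅_⁆)
  open QuotientGains Γ G π quotient T mf φ gain
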